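{- Let $P$ be a finite set partially ordered by $\leq$. For every $P$-labelled tree $(N,E,\lambda)$ there exists a strict $P$-labelled tree $(N',E',\lambda')$ with $(N,E,\lambda)\sim(N',E',\lambda')$.
   Context: A $P$-labelled tree is a triple $(N,E,\lambda)$ where $(N,E)$ is a finite (rooted) tree with edge relation $E$ (parent to child) and $\lambda:N\to P$ satisfies $\lambda(i)\leq\lambda(j)$ whenever $iEj$. It is strict if $iEj$ implies $\lambda(i)<\lambda(j)$ (i.e. $\lambda(i)\leq\lambda(j)$ and $\lambda(i)\neq\lambda(j)$). A $P$-embedding of $(N,E,\lambda)$ into $(N',E',\lambda')$ is a function $f:N\to N'$ such that $iEj$ implies $f(i)\,E'^{\star}\,f(j)$ ($E'^{\star}$ the reflexive-transitive closure of $E'$) and $\lambda(k)=\lambda'(f(k))$ for all $k$; $\sim$ holds iff there are $P$-embeddings in both directions. -}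

module Defs where

open import Data.Nat using (ℕ)
open import Data.Fin using (Fin)
open import Data.Product using (∃; _×_)
open import Relation.Nullary using (¬_)
open import Relation.Binary.PropositionalEquality using (_≡_; _≢_)
open import Relation.Binary.Construct.Closure.ReflexiveTransitive using (Star)

record IsRootedTree {m : ℕ} (E : Fin m → Fin m → Set) : Set where
  field
    root          : Fin m
    root-parentless : ∀ i → ¬ E i root
    unique-parent : ∀ j → j ≢ root → ∃ λ i → E i j × (∀ i' → E i' j → i' ≡ i)
    reachable     : ∀ j → Star E root j

record LabelledTree (A : Set) (_≤_ : A → A → Set) : Set₁ where
  field
    size   : ℕ
    E      : Fin size → Fin size → Set
    isTree : IsRootedTree E
    label  : Fin size → A
    mono   : ∀ i j → E i j → label i ≤ label j

open LabelledTree public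

IsStrict : {A : Set} {_≤_ : A → A → Set} → LabelledTree A _≤_ → Set
IsStrict {_≤_ = _≤_} T = ∀ i j → E T i j → label T i ≤ label T j × label T i ≢ label T j

record PEmbedding {A : Set} {_≤_ : A → A → Set} (T T' : LabelledTree A _≤_) : Set where
  field
    fun      : Fin (size T) → Fin (size T')
    edges    : ∀ i j → E T i j → Star (E T') (fun i) (fun j)
    labels   : ∀ k → label T k ≡ label T' (fun k)

_∼_ : {A : Set} {_≤_ : A → A → Set} → LabelledTree A _≤_ → LabelledTree A _≤_ → Set
T ∼ T' = PEmbedding T T' × PEmbedding T' T

-- Collapse every maximal block of nodes joined by equal-label edges to its topmost node, the head.
-- The heads form a tree under "the parent of my head lies in your block"; its edges cross a label
-- change, so it is strict. Sending a node to its block and a head to itself are P-embeddings both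
-- ways, since a node has the label of its head and every head is an ancestor of its block.
module Submission where

open import Defs
open import Data.Bool using (if_then_else_)
open import Data.Empty using (⊥-elim)
open import Data.Fin using (Fin; zero; suc; _≟_)
open import Data.Fin.Properties using (suc-injective)
open import Data.Nat using (ℕ; zero; suc; _≤_)
open import Data.Nat.Properties using (≤-refl; ≤-trans; n≤1+n; ≤-reflexive; 1+n≰n)
open import Data.Product using (∃; _×_; _,_; proj₁; proj₂)
open import Data.Sum using (_⊎_; inj₁; inj₂)
open import Function using (_∘_; id)
open import Function.Bundles using (_↔_)
open import Function.Definitions using (Injective)
open import Function.Properties.Inverse using (↔⇒↣)
open import Level using (Level)
open import Relation.Binary.Construct.Closure.ReflexiveTransitive using (Star; ε; _◅_; _◅◅_; gfoldl)
open import Relation.Binary.Definitions using (DecidableEquality)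
open import Relation.Binary.PropositionalEquality
open import Relation.Binary.Structures using (IsPartialOrder)
open import Relation.Nullary using (¬_; yes; no; does)
open import Relation.Nullary.Decidable using (via-injection)
open import Relation.Unary using (Pred; Decidable)

record Enumeration {ℓ : Level} {m : ℕ} (P : Pred (Fin m) ℓ) (k : ℕ) : Set ℓ where
  field
    elem           : Fin k → Fin m
    elem-∈         : ∀ x → P (elem x)
    index          : ∀ i → P i → Fin k
    elem-index     : ∀ {i} (p : P i) → elem (index i p) ≡ i
    elem-injective : Injective _≡_ _≡_ elem

enumerate : ∀ {ℓ m} {P : Pred (Fin m) ℓ} → Decidable P → ∃ (Enumeration P)
enumerate {m = zero} P? = 0 , record
  { elem = λ () ; elem-∈ = λ () ; index = λ () ; elem-index = λ { {()} } ; elem-injective = λ { {()} } }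
enumerate {m = suc m} {P} P? with P? zero | enumerate (P? ∘ suc)
... | yes p₀ | k , e = suc k , record
  { elem = elem ; elem-∈ = elem-∈ ; index = index ; elem-index = elem-index ; elem-injective = elem-injective }
  where
  module e = Enumeration e
  elem : Fin (suc k) → Fin (suc m)
  elem zero    = zero
  elem (suc x) = suc (e.elem x)
  elem-∈ : ∀ x → P (elem x)
  elem-∈ zero    = p₀
  elem-∈ (suc x) = e.elem-∈ x
  index : ∀ i → P i → Fin (suc k)
  index zero    _ = zero
  index (suc i) p = suc (e.index i p)
  elem-index : ∀ {i} (p : P i) → elem (index i p) ≡ i
  elem-index {zero}  _ = refl
  elem-index {suc i} p = cong suc (e.elem-index p)
  elem-injective : Injective _≡_ _≡_ elem
  elem-injective {zero}  {zero}  _  = refl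
  elem-injective {suc x} {suc y} eq = cong suc (e.elem-injective (suc-injective eq))
... | no ¬p₀ | k , e = k , record
  { elem = suc ∘ e.elem ; elem-∈ = e.elem-∈ ; index = index ; elem-index = elem-index
  ; elem-injective = e.elem-injective ∘ suc-injective }
  where
  module e = Enumeration e
  index : ∀ i → P i → Fin k
  index zero    p = ⊥-elim (¬p₀ p)
  index (suc i) p = e.index i p
  elem-index : ∀ {i} (p : P i) → suc (e.elem (index i p)) ≡ i
  elem-index {zero}  p = ⊥-elim (¬p₀ p)
  elem-index {suc i} p = cong suc (e.elem-index p)

module RootedTree {m : ℕ} {E : Fin m → Fin m → Set} (tree : IsRootedTree E) where

  open IsRootedTree tree

  child≢root : ∀ {i j} → E i j → j ≢ root
  child≢root {i} e refl = root-parentless i e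

  parent-unique : ∀ {i i' j} → E i j → E i' j → i ≡ i'
  parent-unique {i} {i'} {j} e e' with unique-parent j (child≢root e)
  ... | _ , _ , unique = trans (unique i e) (sym (unique i' e'))

  tree-induction : {P : Fin m → Set} → P root → (∀ {i j} → E i j → P i → P j) → ∀ k → P k
  tree-induction {P} p-root p-child k =
    gfoldl {T = E} id (λ _ → P) (λ p e → p-child e p) {root} p-root (reachable k)

  data Path : Fin m → Set where
    here : Path root
    step : ∀ {i j} → Path i → E i j → Path j

  foldPath : {X : Set} → X → (Fin m → Fin m → X → X) → ∀ {k} → Path k → X
  foldPath z s here               = z
  foldPath z s (step {i} {j} p _) = s i j (foldPath z s p)

  foldPath-irrelevant : {X : Set} (z : X) (s : Fin m → Fin m → X → X)
    → ∀ {k} (p q : Path k) → foldPath z s p ≡ foldPath z s q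
  foldPath-irrelevant z s here       here        = refl
  foldPath-irrelevant z s here       (step _ e)  = ⊥-elim (child≢root e refl)
  foldPath-irrelevant z s (step _ e) here        = ⊥-elim (child≢root e refl)
  foldPath-irrelevant z s (step {i} {j} p e) (step q e') with parent-unique e e'
  ... | refl = cong (s i j) (foldPath-irrelevant z s p q)

  path : ∀ k → Path k
  path = tree-induction here (λ e p → step p e)

  -- Recursion from the root down the tree: independent of the chosen path because parents are unique.
  rec : {X : Set} → X → (Fin m → Fin m → X → X) → Fin m → X
  rec z s k = foldPath z s (path k)

  rec-root : {X : Set} (z : X) (s : Fin m → Fin m → X → X) → rec z s root ≡ z
  rec-root z s = foldPath-irrelevant z s (path root) here

  rec-child : {X : Set} {z : X} {s : Fin m → Fin m → X → X}
    → ∀ {i j} → E i j → rec z s j ≡ s i j (rec z s i)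
  rec-child {z = z} {s} {i} {j} e = foldPath-irrelevant z s (path j) (step (path i) e)

  depth : Fin m → ℕ
  depth = rec 0 (λ _ _ → suc)

  depth-mono : ∀ {i j} → Star E i j → depth i ≤ depth j
  depth-mono ε        = ≤-refl
  depth-mono (e ◅ es) = ≤-trans (≤-trans (n≤1+n _) (≤-reflexive (sym (rec-child e)))) (depth-mono es)

  no-back-edge : ∀ {i j} → Star E i j → ¬ E j i
  no-back-edge es e = 1+n≰n (≤-trans (≤-reflexive (sym (rec-child e))) (depth-mono es))

module Contraction {A : Set} (_≟ᴬ_ : DecidableEquality A)
  {m : ℕ} {E : Fin m → Fin m → Set} (tree : IsRootedTree E) (lab : Fin m → A) where

  open IsRootedTree tree
  open RootedTree tree

  -- head k: the topmost ancestor of k reachable through edges with equal labels.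
  head-step : Fin m → Fin m → Fin m → Fin m
  head-step i j h = if does (lab i ≟ᴬ lab j) then h else j

  head : Fin m → Fin m
  head = rec root head-step

  head-root : head root ≡ root
  head-root = rec-root root head-step

  head-child : ∀ {i j} → E i j
    → (lab i ≡ lab j × head j ≡ head i) ⊎ (lab i ≢ lab j × head j ≡ j)
  head-child {i} {j} e with lab i ≟ᴬ lab j | rec-child {z = root} {head-step} e
  ... | yes eq | h = inj₁ (eq , h)
  ... | no neq | h = inj₂ (neq , h)

  head-label : ∀ k → lab (head k) ≡ lab k
  head-label = tree-induction (cong lab head-root) step-label
    where
    step-label : ∀ {i j} → E i j → lab (head i) ≡ lab i → lab (head j) ≡ lab j
    step-label e ih with head-child e
    ... | inj₁ (eq , h) = trans (cong lab h) (trans ih eq)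
    ... | inj₂ (_ , h)  = cong lab h

  head-ancestor : ∀ k → Star E (head k) k
  head-ancestor = tree-induction (subst (λ r → Star E r root) (sym head-root) ε) step-ancestor
    where
    step-ancestor : ∀ {i j} → E i j → Star E (head i) i → Star E (head j) j
    step-ancestor {i} {j} e ih with head-child e
    ... | inj₁ (_ , h) = subst (λ r → Star E r j) (sym h) (ih ◅◅ e ◅ ε)
    ... | inj₂ (_ , h) = subst (λ r → Star E r j) (sym h) ε

  head-idempotent : ∀ k → head (head k) ≡ head k
  head-idempotent = tree-induction (cong head head-root) step-idempotent
    where
    step-idempotent : ∀ {i j} → E i j → head (head i) ≡ head i → head (head j) ≡ head j
    step-idempotent e ih with head-child e
    ... | inj₁ (_ , h) = trans (cong head h) (trans ih (sym h))
    ... | inj₂ (_ , h) = cong head h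

  parent-of-head-label-≢ : ∀ {i j} → E i j → head j ≡ j → lab i ≢ lab j
  parent-of-head-label-≢ {i} e hj eq with head-child e
  ... | inj₁ (_ , h)   =
    no-back-edge (subst (λ r → Star E r i) (trans (sym h) hj) (head-ancestor i)) e
  ... | inj₂ (neq , _) = neq eq

  heads : ∃ (Enumeration (λ k → head k ≡ k))
  heads = enumerate (λ k → head k ≟ k)

  size' : ℕ
  size' = proj₁ heads

  open Enumeration (proj₂ heads) public using (elem; elem-∈; elem-injective)
  open Enumeration (proj₂ heads) using (index; elem-index)

  block : Fin m → Fin size'
  block k = index (head k) (head-idempotent k)

  elem-block : ∀ k → elem (block k) ≡ head k
  elem-block k = elem-index (head-idempotent k)

  block-elem : ∀ x → block (elem x) ≡ x
  block-elem x = elem-injective (trans (elem-block (elem x)) (elem-∈ x))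

  block-≡ : ∀ {i j} → head i ≡ head j → block i ≡ block j
  block-≡ {i} {j} h = elem-injective (trans (elem-block i) (trans h (sym (elem-block j))))

  block-label : ∀ k → lab (elem (block k)) ≡ lab k
  block-label k = trans (cong lab (elem-block k)) (head-label k)

  E' : Fin size' → Fin size' → Set
  E' x y = ∃ λ p → E p (elem y) × block p ≡ x

  block-star : ∀ {i j} → E i j → Star E' (block i) (block j)
  block-star {i} {j} e with head-child e
  ... | inj₁ (_ , h) = subst (Star E' (block i)) (block-≡ (sym h)) ε
  ... | inj₂ (_ , h) = (i , subst (E i) (sym (trans (elem-block j) h)) e , refl) ◅ ε

  elem-star : ∀ {x y} → E' x y → Star E (elem x) (elem y)
  elem-star {y = y} (p , e , refl) =
    subst (λ r → Star E r (elem y)) (sym (elem-block p)) (head-ancestor p ◅◅ e ◅ ε)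

  elem-root : elem (block root) ≡ root
  elem-root = trans (elem-block root) head-root

  isTree' : IsRootedTree E'
  isTree' = record
    { root            = block root
    ; root-parentless = λ { _ (_ , e , _) → child≢root e elem-root }
    ; unique-parent   = unique-parent'
    ; reachable       = λ y → subst (Star E' (block root)) (block-elem y) (reachable-block (elem y))
    }
    where
    unique-parent' : ∀ y → y ≢ block root → ∃ λ x → E' x y × (∀ x' → E' x' y → x' ≡ x)
    unique-parent' y y≢root
      with unique-parent (elem y) (λ eq → y≢root (trans (sym (block-elem y)) (cong block eq)))
    ... | p , e , unique =
      block p , (p , e , refl) , λ { _ (p' , e' , refl) → cong block (unique p' e') }
    reachable-block : ∀ k → Star E' (block root) (block k)
    reachable-block = tree-induction ε (λ e path → path ◅◅ block-star e)

strictify : {A : Set} {_≤_ : A → A → Set} → DecidableEquality A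
  → (T : LabelledTree A _≤_) → ∃ λ (T' : LabelledTree A _≤_) → IsStrict T' × (T ∼ T')
strictify {A} {_≤_} _≟ᴬ_ T = T' , strict , embedding , embedding'
  where
  open Contraction _≟ᴬ_ (isTree T) (label T)

  mono' : ∀ x y → E' x y → label T (elem x) ≤ label T (elem y)
  mono' _ y (p , e , refl) = subst (_≤ label T (elem y)) (sym (block-label p)) (mono T p _ e)

  T' : LabelledTree A _≤_
  T' = record { size = size' ; E = E' ; isTree = isTree' ; label = label T ∘ elem ; mono = mono' }

  strict : IsStrict T'
  strict x y e'@(p , e , refl) =
    mono' x y e' , λ eq → parent-of-head-label-≢ e (elem-∈ y) (trans (sym (block-label p)) eq)

  embedding : PEmbedding T T'
  embedding = record
    { fun = block ; edges = λ _ _ → block-star ; labels = λ k → sym (block-label k) }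

  embedding' : PEmbedding T' T
  embedding' = record { fun = elem ; edges = λ _ _ → elem-star ; labels = λ _ → refl }

-- Finiteness of P is only used to decide equality of labels.
lemma3 : (A : Set) (_≤_ : A → A → Set) → IsPartialOrder _≡_ _≤_
    → (n : ℕ) → A ↔ Fin n
    → (T : LabelledTree A _≤_) → ∃ λ (T' : LabelledTree A _≤_) → IsStrict T' × (T ∼ T')
lemma3 _ _ _ _ A↔Fin = strictify (via-injection (↔⇒↣ A↔Fin) _≟_)
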